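{- Let $P=\langle L,\ell^o,\ell^e,V,\tau_P\rangle$ be a program and run the algorithm SPACER (described in the context) on $P$. Then at every iteration of SPACER the current invariant map $\mathcal{I}: L\to 2^{\mathrm{BExpr}(V)}$ is inductive with respect to $\tau_P$, i.e. $\top \Rightarrow \bigwedge \mathcal{I}(\ell^o)$ and for all $\ell_i,\ell_j\in L$, $\left(\bigwedge\mathcal{I}(\ell_i)\wedge \tau_P(\ell_i,\ell_j)\right)\Rightarrow \bigwedge \mathcal{I}(\ell_j)'$.
   Context: A program is a tuple $P=\langle L,\ell^o,\ell^e,V,\tau\rangle$: $L$ a finite set of control locations, $\ell^o,\ell^e\in L$ the initial and error locations, $V$ a set of Boolean or rational variables, and $\tau:L\times L\to \mathrm{BExpr}(V\cup V')$ mapping pairs of locations to quantifier-free formulas of propositional linear rational arithmetic over current variables $V$ and primed next-state copies $V'$; it is assumed that $\tau(\ell,\ell^o)=\bot$ and $\tau(\ell^e,\ell)=\bot$ for all $\ell$. For a formula $X$, $X'$ is $X$ with all variables primed. A control path is a sequence $\ell^o=\ell_0,\ell_1,\dots,\ell_k$ with $\tau(\ell_i,\ell_{i+1})\neq\bot$; it is feasible if there are states (valuations of $V$) $s_0,\dots,s_k$ with $\tau(\ell_i,\ell_{i+1})[V\leftarrow s_i,V'\leftarrow s_{i+1}]=\top$ for all $i<k$. A counterexample is a pair $\langle\bar\ell,\bar s\rangle$ of a feasible control path ending in $\ell^e$ and a witnessing state sequence; $P$ is safe iff $\ell^e$ lies at the end of no feasible control path. A safety proof is $\pi:L\to 2^{\mathrm{BExpr}(V)}$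 with $\bigwedge\pi(\ell^e)\Rightarrow\bot$, $\top\Rightarrow\bigwedge\pi(\ell^o)$ and $(\bigwedge\pi(\ell_i)\wedge\tau(\ell_i,\ell_j))\Rightarrow\bigwedge\pi(\ell_j)'$ for all $\ell_i,\ell_j$. For programs $P_1,P_2$ and a surjection $\sigma:L_1\to L_2$, $P_1\preceq_\sigma P_2$ ($P_2$ abstracts $P_1$) iff $V_1=V_2$, $\sigma(\ell^o_1)=\ell^o_2$, $\sigma(\ell^e_1)=\ell^e_2$ and $\tau_1(\ell_i,\ell_j)\Rightarrow\tau_2(\sigma(\ell_i),\sigma(\ell_j))$ for all $\ell_i,\ell_j\in L_1$; $P_1\prec_\sigma P_2$ iff $P_1\preceq_\sigma P_2$ and there is no surjection $\nu$ with $P_2\preceq_\nu P_1$. For a transition relation $\tau$ on $L_2$, $\sigma(\tau)(\ell_1,\ell_2)=\tau(\sigma(\ell_1),\sigma(\ell_2))$; $\sigma(\langle\bar\ell,\bar s\rangle)=\langle\sigma(\bar\ell),\bar s\rangle$. $\mathrm{Adapt}(U,\tau,\sigma)$ is $U$ with $\tau_U$ replaced by $\tau_U\wedge\sigma(\tau)$. Algorithm SPACER on input $P$: it maintains $\mathcal{I}:L_P\to 2^{\mathrm{BExpr}(V_P)}$ (initially $\mathcal{I}(\ell)=\emptyset$ for all $\ell$), an abstraction $A$ (initially $A=P$; always $A$ differs from $P$ only in its transition relation) and an under-approximation $U$ with a surjection $\sigma:L_U\to L_P$ such that $U\preceq_\sigma A$ (initially arbitrary such $U,\sigma$). For $U\preceq_\sigma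 A$, $U_{\mathcal{I}}$ denotes $U$ with $\tau_U$ strengthened to $\lambda\ell_1,\ell_2.\ \bigwedge\mathcal{I}(\sigma(\ell_1))\wedge\tau_U(\ell_1,\ell_2)\wedge\bigwedge\mathcal{I}(\sigma(\ell_2))'$ (and $A_{\mathcal{I}}$ similarly with $\sigma=\mathrm{id}$). Each iteration calls an oracle Solve on $U_{\mathcal{I}}$, which returns either a safety proof $\pi$ of $U_{\mathcal{I}}$ or a counterexample $\mathscr{C}$ of $U_{\mathcal{I}}$. (Safe case.) ExtractInvs: for each $\ell\in L_P$ let $\mathcal{R}(\ell)$ be the set of conjuncts of $\bigvee\{\bigwedge\pi(u): u\in L_U,\sigma(u)=\ell\}$; then, while there exist $\ell_i,\ell_j\in L_P$ and $\varphi\in\mathcal{R}(\ell_j)$ such that $\bigwedge\mathcal{R}(\ell_i)\wedge\bigwedge\mathcal{I}(\ell_i)\wedge\tau_P(\ell_i,\ell_j)\not\Rightarrow\varphi'$, remove $\varphi$ from $\mathcal{R}(\ell_j)$; then set $\mathcal{I}(\ell):=\mathcal{I}(\ell)\cup\mathcal{R}(\ell)$ for all $\ell$. If $\bigwedge\mathcal{I}(\ell^e)\Rightarrow\bot$, return SAFE. Otherwise Abstract: writing $\tau_U=\sigma(\tau_A)\wedge\rho$, choose $\hat\tau_P$ with $\tau_P\Rightarrow\hat\tau_P$ and $\hat\rho$ with $\rho\Rightarrow\hat\rho$ such that, for $\hat U$ equal to $U$ but with $\tau_{\hat U}=\sigma(\hat\tau_P)\wedge\hat\rho$, $\pi$ is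 a safety proof of $\hat U_{\mathcal{I}}$; set $A:=A$ with $\tau_A$ replaced by $\hat\tau_P$ and $U:=\hat U$. Then NextU: choose $\hat U$, $\sigma_1,\sigma_2$ with $U\prec_{\sigma_1}\hat U\preceq_{\sigma_2}A$, $\sigma=\sigma_2\circ\sigma_1$ and $\mathrm{Adapt}(U,\tau_P,\sigma)\prec\mathrm{Adapt}(\hat U,\tau_P,\sigma_2)$; set $U:=\hat U$, $\sigma:=\sigma_2$. (Unsafe case.) Refine: if $\sigma(\mathscr{C})$ is a counterexample of $P$, return UNSAFE; otherwise choose $A_{new}$ with $A_{new}\prec_{\mathrm{id}}A$ such that $\sigma(\mathscr{C})$ is not a counterexample of $(A_{new})_{\mathcal{I}}$, and set $A:=A_{new}$, $U:=\mathrm{Adapt}(U,\tau_{A_{new}},\sigma)$. -}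

module Defs where

open import Data.Bool using (Bool; T)
open import Data.Nat using (ℕ; suc)
open import Data.Fin using (Fin; zero; suc; inject₁; fromℕ; _≟_)
open import Data.Sum using (_⊎_; inj₁; inj₂; [_,_])
open import Data.Product using (_×_; _,_; proj₁; proj₂; ∃; ∃-syntax; Σ)
open import Data.List using (List; []; _∷_; _++_; map; filter; allFin)
open import Data.List.Membership.Propositional using (_∈_)
open import Data.Rational as ℚ using (ℚ)
open import Data.Empty using (⊥)
open import Data.Unit using (⊤)
open import Relation.Nullary using (¬_; yes; no)
open import Relation.Binary.PropositionalEquality using (_≡_; _≢_)

-- Quantifier-free formulas of propositional linear rational arithmetic
-- over Boolean variables (names in B) and rational variables (names in R).

data LTerm (R : Set) : Set where
  con  : ℚ → LTerm R
  var  : R → LTerm R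
  _⊕_  : LTerm R → LTerm R → LTerm R
  _⊛_  : ℚ → LTerm R → LTerm R

data BExpr (B R : Set) : Set where
  ⊤ᶠ ⊥ᶠ     : BExpr B R
  bv        : B → BExpr B R
  _≤ᶠ_ _<ᶠ_ _≐ᶠ_ : LTerm R → LTerm R → BExpr B R
  ¬ᶠ_       : BExpr B R → BExpr B R
  _∧ᶠ_ _∨ᶠ_ : BExpr B R → BExpr B R → BExpr B R

module _ {R : Set} where
  evalT : LTerm R → (R → ℚ) → ℚ
  evalT (con q) ρ = q
  evalT (var x) ρ = ρ x
  evalT (t ⊕ u) ρ = evalT t ρ ℚ.+ evalT u ρ
  evalT (q ⊛ t) ρ = q ℚ.* evalT t ρ

  mapT : {R' : Set} → (R → R') → LTerm R → LTerm R'
  mapT f (con q) = con q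
  mapT f (var x) = var (f x)
  mapT f (t ⊕ u) = mapT f t ⊕ mapT f u
  mapT f (q ⊛ t) = q ⊛ mapT f t

module _ {B R : Set} where
  ⟦_⟧ : BExpr B R → (B → Bool) → (R → ℚ) → Set
  ⟦ ⊤ᶠ ⟧ β ρ = ⊤
  ⟦ ⊥ᶠ ⟧ β ρ = ⊥
  ⟦ bv b ⟧ β ρ = T (β b)
  ⟦ t ≤ᶠ u ⟧ β ρ = evalT t ρ ℚ.≤ evalT u ρ
  ⟦ t <ᶠ u ⟧ β ρ = evalT t ρ ℚ.< evalT u ρ
  ⟦ t ≐ᶠ u ⟧ β ρ = evalT t ρ ≡ evalT u ρ
  ⟦ ¬ᶠ φ ⟧ β ρ = ¬ ⟦ φ ⟧ β ρ
  ⟦ φ ∧ᶠ ψ ⟧ β ρ = ⟦ φ ⟧ β ρ × ⟦ ψ ⟧ β ρ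
  ⟦ φ ∨ᶠ ψ ⟧ β ρ = ⟦ φ ⟧ β ρ ⊎ ⟦ ψ ⟧ β ρ

  _⟹_ : BExpr B R → BExpr B R → Set
  φ ⟹ ψ = ∀ β ρ → ⟦ φ ⟧ β ρ → ⟦ ψ ⟧ β ρ

  ⋀ : List (BExpr B R) → BExpr B R
  ⋀ [] = ⊤ᶠ
  ⋀ (φ ∷ []) = φ
  ⋀ (φ ∷ ψ ∷ ψs) = φ ∧ᶠ ⋀ (ψ ∷ ψs)

  ⋁ : List (BExpr B R) → BExpr B R
  ⋁ [] = ⊥ᶠ
  ⋁ (φ ∷ []) = φ
  ⋁ (φ ∷ ψ ∷ ψs) = φ ∨ᶠ ⋁ (ψ ∷ ψs)

  conjuncts : BExpr B R → List (BExpr B R)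
  conjuncts ⊤ᶠ = []
  conjuncts (φ ∧ᶠ ψ) = conjuncts φ ++ conjuncts ψ
  conjuncts φ = φ ∷ []

  mapF : {B' R' : Set} → (B → B') → (R → R') → BExpr B R → BExpr B' R'
  mapF f g ⊤ᶠ = ⊤ᶠ
  mapF f g ⊥ᶠ = ⊥ᶠ
  mapF f g (bv b) = bv (f b)
  mapF f g (t ≤ᶠ u) = mapT g t ≤ᶠ mapT g u
  mapF f g (t <ᶠ u) = mapT g t <ᶠ mapT g u
  mapF f g (t ≐ᶠ u) = mapT g t ≐ᶠ mapT g u
  mapF f g (¬ᶠ φ) = ¬ᶠ mapF f g φ
  mapF f g (φ ∧ᶠ ψ) = mapF f g φ ∧ᶠ mapF f g ψ
  mapF f g (φ ∨ᶠ ψ) = mapF f g φ ∨ᶠ mapF f g ψ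

  data Without (φ : BExpr B R) : List (BExpr B R) → List (BExpr B R) → Set where
    []ʷ   : Without φ [] []
    dropʷ : ∀ {xs ys} → Without φ xs ys → Without φ (φ ∷ xs) ys
    keepʷ : ∀ {x xs ys} → x ≢ φ → Without φ xs ys → Without φ (x ∷ xs) (x ∷ ys)

-- Everything below is relative to a fixed variable set V consisting of
-- nb Boolean variables and nr rational variables.

module _ (nb nr : ℕ) where

  Formula : Set
  Formula = BExpr (Fin nb) (Fin nr)

  -- formulas over V ∪ V'  (inj₁ = current copy, inj₂ = primed copy)
  TFormula : Set
  TFormula = BExpr (Fin nb ⊎ Fin nb) (Fin nr ⊎ Fin nr)

  State : Set
  State = (Fin nb → Bool) × (Fin nr → ℚ)

  cur nxt : Formula → TFormula
  cur = mapF inj₁ inj₁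
  nxt = mapF inj₂ inj₂

  Holds : TFormula → State → State → Set
  Holds φ s s' = ⟦ φ ⟧ [ proj₁ s , proj₁ s' ] [ proj₂ s , proj₂ s' ]

  -- programs ⟨L, ℓᵒ, ℓᵉ, V, τ⟩ with L = Fin k (V is fixed above)
  record Program : Set where
    field
      k    : ℕ
      init : Fin k
      err  : Fin k
      τ    : Fin k → Fin k → TFormula
  open Program public

  WellFormed : Program → Set
  WellFormed P = (∀ ℓ → τ P ℓ (init P) ⟹ ⊥ᶠ) × (∀ ℓ → τ P (err P) ℓ ⟹ ⊥ᶠ)

  withτ : (Q : Program) → (Fin (k Q) → Fin (k Q) → TFormula) → Program
  withτ Q t = record { k = k Q ; init = init Q ; err = err Q ; τ = t }

  pull : {k₁ k₂ : ℕ} → (Fin k₁ → Fin k₂) → (Fin k₂ → Fin k₂ → TFormula) → Fin k₁ → Fin k₁ → TFormula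
  pull σ t ℓ₁ ℓ₂ = t (σ ℓ₁) (σ ℓ₂)

  Adapt : (U : Program) {k₂ : ℕ} → (Fin k₂ → Fin k₂ → TFormula) → (Fin (k U) → Fin k₂) → Program
  Adapt U t σ = withτ U (λ a b → τ U a b ∧ᶠ pull σ t a b)

  strengthen : (U : Program) {k₂ : ℕ} → (Fin (k U) → Fin k₂) → (Fin k₂ → List Formula) → Program
  strengthen U σ I = withTτ
    where
      withTτ = withτ U (λ a b → (cur (⋀ (I (σ a))) ∧ᶠ τ U a b) ∧ᶠ nxt (⋀ (I (σ b))))

  SafetyProof : (Q : Program) → (Fin (k Q) → List Formula) → Set
  SafetyProof Q π =
      (⋀ (π (err Q)) ⟹ ⊥ᶠ)
    × (⊤ᶠ ⟹ ⋀ (π (init Q)))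
    × (∀ i j → (cur (⋀ (π i)) ∧ᶠ τ Q i j) ⟹ nxt (⋀ (π j)))

  record Trace (k₀ : ℕ) : Set where
    field
      len : ℕ
      loc : Fin (suc len) → Fin k₀
      st  : Fin (suc len) → State
  open Trace public

  mapTrace : {k₁ k₂ : ℕ} → (Fin k₁ → Fin k₂) → Trace k₁ → Trace k₂
  mapTrace σ c = record { len = len c ; loc = λ i → σ (loc c i) ; st = st c }

  IsCex : (Q : Program) → Trace (k Q) → Set
  IsCex Q c =
      (loc c zero ≡ init Q)
    × (loc c (fromℕ (len c)) ≡ err Q)
    × (∀ (i : Fin (len c)) →
         Holds (τ Q (loc c (inject₁ i)) (loc c (suc i))) (st c (inject₁ i)) (st c (suc i)))

  Surjective : {k₁ k₂ : ℕ} → (Fin k₁ → Fin k₂) → Set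
  Surjective σ = ∀ y → ∃ λ x → σ x ≡ y

  _⪯_via_ : (P₁ P₂ : Program) → (Fin (k P₁) → Fin (k P₂)) → Set
  P₁ ⪯ P₂ via σ =
      Surjective σ
    × (σ (init P₁) ≡ init P₂)
    × (σ (err P₁) ≡ err P₂)
    × (∀ i j → τ P₁ i j ⟹ τ P₂ (σ i) (σ j))

  _≺_via_ : (P₁ P₂ : Program) → (Fin (k P₁) → Fin (k P₂)) → Set
  P₁ ≺ P₂ via σ = (P₁ ⪯ P₂ via σ) × ¬ (∃ λ ν → P₂ ⪯ P₁ via ν)

  _≺_ : Program → Program → Set
  P₁ ≺ P₂ = ∃ λ σ → P₁ ≺ P₂ via σ

  -- SPACER, as a nondeterministic transition system on configurations.

  data Status : Set where
    running safe unsafe : Status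

  record Config (P : Program) : Set where
    field
      I      : Fin (k P) → List Formula
      τA     : Fin (k P) → Fin (k P) → TFormula         -- A = P with τ replaced by τA
      U      : Program
      σ      : Fin (k U) → Fin (k P)
      status : Status
  open Config public

  module _ (P : Program) where

    InvMap : Set
    InvMap = Fin (k P) → List Formula

    Inductive : InvMap → Set
    Inductive I =
        (⊤ᶠ ⟹ ⋀ (I (init P)))
      × (∀ i j → (cur (⋀ (I i)) ∧ᶠ τ P i j) ⟹ nxt (⋀ (I j)))

    Kept : InvMap → InvMap → Fin (k P) → Fin (k P) → Formula → Set
    Kept I R i j φ = ((cur (⋀ (R i)) ∧ᶠ cur (⋀ (I i))) ∧ᶠ τ P i j) ⟹ nxt φ

    update : InvMap → Fin (k P) → List Formula → InvMap
    update R j ys j' with j' ≟ j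
    ... | yes _ = ys
    ... | no  _ = R j'

    -- the pruning loop of ExtractInvs: Prune I R R' means the loop, started
    -- with R, can terminate with R'
    data Prune (I : InvMap) : InvMap → InvMap → Set where
      stop   : ∀ {R} → ¬ (∃[ i ] ∃[ j ] ∃[ φ ] (φ ∈ R j × ¬ Kept I R i j φ)) → Prune I R R
      remove : ∀ {R R'} i j φ {ys} → φ ∈ R j → ¬ Kept I R i j φ →
               Without φ (R j) ys → Prune I (update R j ys) R' → Prune I R R'

    R₀ : (U : Program) → (Fin (k U) → Fin (k P)) → (Fin (k U) → List Formula) → InvMap
    R₀ U σ π ℓ = conjuncts (⋁ (map (λ u → ⋀ (π u)) (filter (λ u → σ u ≟ ℓ) (allFin (k U)))))

    ExtractInvs : (U : Program) → (Fin (k U) → Fin (k P)) → (Fin (k U) → List Formula) →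
                  InvMap → InvMap → Set
    ExtractInvs U σ π I I' = ∃ λ R → Prune I (R₀ U σ π) R × (∀ ℓ → I' ℓ ≡ I ℓ ++ R ℓ)

    Abs : Config P → Program
    Abs c = withτ P (τA c)

    data Step (c : Config P) : Config P → Set where
      safe-return :
        status c ≡ running →
        (π : Fin (k (U c)) → List Formula) → SafetyProof (strengthen (U c) (σ c) (I c)) π →
        (I' : InvMap) → ExtractInvs (U c) (σ c) π (I c) I' →
        (⋀ (I' (err P)) ⟹ ⊥ᶠ) →
        Step c record c { I = I' ; status = safe }
      safe-continue :
        status c ≡ running →
        (π : Fin (k (U c)) → List Formula) → SafetyProof (strengthen (U c) (σ c) (I c)) π →
        (I' : InvMap) → ExtractInvs (U c) (σ c) π (I c) I' →
        ¬ (⋀ (I' (err P)) ⟹ ⊥ᶠ) →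
        -- Abstract
        (ρ : Fin (k (U c)) → Fin (k (U c)) → TFormula) →
        (∀ a b → τ (U c) a b ⟹ (pull (σ c) (τA c) a b ∧ᶠ ρ a b)) →
        (∀ a b → (pull (σ c) (τA c) a b ∧ᶠ ρ a b) ⟹ τ (U c) a b) →
        (τ̂ : Fin (k P) → Fin (k P) → TFormula) → (∀ i j → τ P i j ⟹ τ̂ i j) →
        (ρ̂ : Fin (k (U c)) → Fin (k (U c)) → TFormula) → (∀ a b → ρ a b ⟹ ρ̂ a b) →
        let Uₐ = withτ (U c) (λ a b → pull (σ c) τ̂ a b ∧ᶠ ρ̂ a b) in
        SafetyProof (strengthen Uₐ (σ c) I') π →
        -- NextU
        (Û : Program) (σ₁ : Fin (k Uₐ) → Fin (k Û)) (σ₂ : Fin (k Û) → Fin (k P)) →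
        Uₐ ≺ Û via σ₁ →
        Û ⪯ withτ P τ̂ via σ₂ →
        (∀ u → σ c u ≡ σ₂ (σ₁ u)) →
        Adapt Uₐ (τ P) (σ c) ≺ Adapt Û (τ P) σ₂ →
        Step c record c { I = I' ; τA = τ̂ ; U = Û ; σ = σ₂ }
      unsafe-return :
        status c ≡ running →
        (C : Trace (k (U c))) → IsCex (strengthen (U c) (σ c) (I c)) C →
        IsCex P (mapTrace (σ c) C) →
        Step c record c { status = unsafe }
      refine :
        status c ≡ running →
        (C : Trace (k (U c))) → IsCex (strengthen (U c) (σ c) (I c)) C →
        ¬ IsCex P (mapTrace (σ c) C) →
        (τnew : Fin (k P) → Fin (k P) → TFormula) →
        withτ P τnew ≺ Abs c via (λ ℓ → ℓ) →
        ¬ IsCex (strengthen (withτ P τnew) (λ ℓ → ℓ) (I c)) (mapTrace (σ c) C) →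
        Step c record c { τA = τnew ; U = Adapt (U c) τnew (σ c) }

    data Reachable : Config P → Set where
      start : (U₀ : Program) (σ₀ : Fin (k U₀) → Fin (k P)) → U₀ ⪯ P via σ₀ →
              Reachable record { I = λ _ → [] ; τA = τ P ; U = U₀ ; σ = σ₀ ; status = running }
      step  : ∀ {c c'} → Reachable c → Step c c' → Reachable c'

-- 𝓘 changes only in ExtractInvs, where it is conjoined with the set 𝓡 left
-- when the pruning loop stops.  At that point every φ ∈ 𝓡(ℓⱼ) satisfies
-- ⋀𝓡(ℓᵢ) ∧ ⋀𝓘(ℓᵢ) ∧ τ_P(ℓᵢ,ℓⱼ) ⇒ φ', i.e. 𝓡 is inductive relative to 𝓘, so
-- 𝓘 ∧ 𝓡 is inductive whenever 𝓘 is and 𝓡(ℓᵒ) is valid.  The latter holds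
-- because 𝓡(ℓᵒ) ⊆ conjuncts of ⋁{⋀π(u) : σ(u) = ℓᵒ}, one disjunct of which
-- is ⋀π at the initial location of U, valid since π is a safety proof.  So
-- "𝓘 is inductive and σ maps the initial location of U to ℓᵒ" is an
-- invariant of SPACER.
module Submission where

open import Defs
open import Data.Nat using (ℕ)
open import Data.Bool using (T?)
open import Data.Fin using (_≟_)
open import Data.Sum using (_⊎_; inj₁; inj₂)
open import Data.Product using (_×_; _,_)
open import Data.List using (List; []; _∷_; _++_; map; filter; allFin)
open import Data.List.Membership.Propositional using (_∈_)
open import Data.List.Membership.Propositional.Properties using (∈-++⁻; ∈-map⁺; ∈-filter⁺; ∈-allFin)
open import Data.List.Relation.Binary.Subset.Propositional using (_⊆_)
open import Data.List.Relation.Unary.Any using (here; there)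
open import Data.List.Relation.Unary.All as All using (All; []; _∷_)
open import Data.List.Relation.Unary.All.Properties using (++⁺; ++⁻)
import Data.Rational as ℚ
open import Data.Empty using (⊥-elim)
open import Data.Unit using (tt)
open import Function using (id; _∘_)
open import Relation.Nullary using (¬_; Dec; yes; no)
open import Relation.Nullary.Decidable using (¬?; _×-dec_; _⊎-dec_)
open import Relation.Binary.PropositionalEquality using (_≡_; refl; sym; cong; cong₂; subst)

module _ {B R : Set} where

  ⟦_⟧? : (φ : BExpr B R) → ∀ β ρ → Dec (⟦ φ ⟧ β ρ)
  ⟦ ⊤ᶠ ⟧? β ρ = yes tt
  ⟦ ⊥ᶠ ⟧? β ρ = no λ ()
  ⟦ bv b ⟧? β ρ = T? (β b)
  ⟦ t ≤ᶠ u ⟧? β ρ = evalT t ρ ℚ.≤? evalT u ρ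
  ⟦ t <ᶠ u ⟧? β ρ = evalT t ρ ℚ.<? evalT u ρ
  ⟦ t ≐ᶠ u ⟧? β ρ = evalT t ρ ℚ.≟ evalT u ρ
  ⟦ ¬ᶠ φ ⟧? β ρ = ¬? (⟦ φ ⟧? β ρ)
  ⟦ φ ∧ᶠ ψ ⟧? β ρ = ⟦ φ ⟧? β ρ ×-dec ⟦ ψ ⟧? β ρ
  ⟦ φ ∨ᶠ ψ ⟧? β ρ = ⟦ φ ⟧? β ρ ⊎-dec ⟦ ψ ⟧? β ρ

  ⟹-stable : (φ ψ : BExpr B R) → ¬ ¬ (φ ⟹ ψ) → φ ⟹ ψ
  ⟹-stable φ ψ ¬¬φ⟹ψ β ρ φ-holds with ⟦ ψ ⟧? β ρ
  ... | yes ψ-holds = ψ-holds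
  ... | no ¬ψ-holds = ⊥-elim (¬¬φ⟹ψ λ φ⟹ψ → ¬ψ-holds (φ⟹ψ β ρ φ-holds))

  ⋀⁻ : ∀ (xs : List (BExpr B R)) {β ρ} → ⟦ ⋀ xs ⟧ β ρ → All (λ φ → ⟦ φ ⟧ β ρ) xs
  ⋀⁻ [] _ = []
  ⋀⁻ (x ∷ []) h = h ∷ []
  ⋀⁻ (x ∷ y ∷ ys) (h , hs) = h ∷ ⋀⁻ (y ∷ ys) hs

  ⋀⁺ : ∀ (xs : List (BExpr B R)) {β ρ} → All (λ φ → ⟦ φ ⟧ β ρ) xs → ⟦ ⋀ xs ⟧ β ρ
  ⋀⁺ [] [] = tt
  ⋀⁺ (x ∷ []) (h ∷ []) = h
  ⋀⁺ (x ∷ y ∷ ys) (h ∷ hs) = h , ⋀⁺ (y ∷ ys) hs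

  ⋀-++⁻ : ∀ (xs ys : List (BExpr B R)) {β ρ} → ⟦ ⋀ (xs ++ ys) ⟧ β ρ → ⟦ ⋀ xs ⟧ β ρ × ⟦ ⋀ ys ⟧ β ρ
  ⋀-++⁻ xs ys h with ++⁻ xs (⋀⁻ (xs ++ ys) h)
  ... | hxs , hys = ⋀⁺ xs hxs , ⋀⁺ ys hys

  ⋀-++⁺ : ∀ (xs ys : List (BExpr B R)) {β ρ} → ⟦ ⋀ xs ⟧ β ρ → ⟦ ⋀ ys ⟧ β ρ → ⟦ ⋀ (xs ++ ys) ⟧ β ρ
  ⋀-++⁺ xs ys hxs hys = ⋀⁺ (xs ++ ys) (++⁺ (⋀⁻ xs hxs) (⋀⁻ ys hys))

  ⋁-∈ : ∀ {φ} (xs : List (BExpr B R)) {β ρ} → φ ∈ xs → ⟦ φ ⟧ β ρ → ⟦ ⋁ xs ⟧ β ρ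
  ⋁-∈ (x ∷ []) (here refl) h = h
  ⋁-∈ (x ∷ y ∷ ys) (here refl) h = inj₁ h
  ⋁-∈ (x ∷ y ∷ ys) (there φ∈ys) h = inj₂ (⋁-∈ (y ∷ ys) φ∈ys h)

  conjuncts-sound : ∀ {ψ} (φ : BExpr B R) {β ρ} → ψ ∈ conjuncts φ → ⟦ φ ⟧ β ρ → ⟦ ψ ⟧ β ρ
  conjuncts-sound ⊤ᶠ ()
  conjuncts-sound ⊥ᶠ (here refl) h = h
  conjuncts-sound (bv _) (here refl) h = h
  conjuncts-sound (_ ≤ᶠ _) (here refl) h = h
  conjuncts-sound (_ <ᶠ _) (here refl) h = h
  conjuncts-sound (_ ≐ᶠ _) (here refl) h = h
  conjuncts-sound (¬ᶠ _) (here refl) h = h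
  conjuncts-sound (_ ∨ᶠ _) (here refl) h = h
  conjuncts-sound (φ ∧ᶠ ψ) ∈φ∧ψ (hφ , hψ) with ∈-++⁻ (conjuncts φ) ∈φ∧ψ
  ... | inj₁ ∈φ = conjuncts-sound φ ∈φ hφ
  ... | inj₂ ∈ψ = conjuncts-sound ψ ∈ψ hψ

  Without-⊆ : ∀ {φ : BExpr B R} {xs ys} → Without φ xs ys → ys ⊆ xs
  Without-⊆ []ʷ ()
  Without-⊆ (dropʷ w) x∈ys = there (Without-⊆ w x∈ys)
  Without-⊆ (keepʷ _ w) (here refl) = here refl
  Without-⊆ (keepʷ _ w) (there x∈ys) = there (Without-⊆ w x∈ys)

module _ {B R B' R' : Set} (f : B → B') (g : R → R') where

  evalT-mapT : ∀ t (ρ : R' → ℚ.ℚ) → evalT (mapT g t) ρ ≡ evalT t (ρ ∘ g)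
  evalT-mapT (con q) ρ = refl
  evalT-mapT (var x) ρ = refl
  evalT-mapT (t ⊕ u) ρ = cong₂ ℚ._+_ (evalT-mapT t ρ) (evalT-mapT u ρ)
  evalT-mapT (q ⊛ t) ρ = cong (q ℚ.*_) (evalT-mapT t ρ)

  ⟦mapF⟧ : ∀ φ β ρ → ⟦ mapF f g φ ⟧ β ρ ≡ ⟦ φ ⟧ (β ∘ f) (ρ ∘ g)
  ⟦mapF⟧ ⊤ᶠ β ρ = refl
  ⟦mapF⟧ ⊥ᶠ β ρ = refl
  ⟦mapF⟧ (bv b) β ρ = refl
  ⟦mapF⟧ (t ≤ᶠ u) β ρ = cong₂ ℚ._≤_ (evalT-mapT t ρ) (evalT-mapT u ρ)
  ⟦mapF⟧ (t <ᶠ u) β ρ = cong₂ ℚ._<_ (evalT-mapT t ρ) (evalT-mapT u ρ)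
  ⟦mapF⟧ (t ≐ᶠ u) β ρ = cong₂ _≡_ (evalT-mapT t ρ) (evalT-mapT u ρ)
  ⟦mapF⟧ (¬ᶠ φ) β ρ = cong ¬_ (⟦mapF⟧ φ β ρ)
  ⟦mapF⟧ (φ ∧ᶠ ψ) β ρ = cong₂ _×_ (⟦mapF⟧ φ β ρ) (⟦mapF⟧ ψ β ρ)
  ⟦mapF⟧ (φ ∨ᶠ ψ) β ρ = cong₂ _⊎_ (⟦mapF⟧ φ β ρ) (⟦mapF⟧ ψ β ρ)

  mapF-⋀⁺ : ∀ (xs : List (BExpr B R)) {β ρ} → All (λ φ → ⟦ mapF f g φ ⟧ β ρ) xs → ⟦ mapF f g (⋀ xs) ⟧ β ρ
  mapF-⋀⁺ xs {β} {ρ} h rewrite ⟦mapF⟧ (⋀ xs) β ρ =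
    ⋀⁺ xs (All.map (λ {φ} → subst id (⟦mapF⟧ φ β ρ)) h)

  mapF-⋀-++⁻ : ∀ (xs ys : List (BExpr B R)) {β ρ} → ⟦ mapF f g (⋀ (xs ++ ys)) ⟧ β ρ →
               ⟦ mapF f g (⋀ xs) ⟧ β ρ × ⟦ mapF f g (⋀ ys) ⟧ β ρ
  mapF-⋀-++⁻ xs ys {β} {ρ}
    rewrite ⟦mapF⟧ (⋀ (xs ++ ys)) β ρ | ⟦mapF⟧ (⋀ xs) β ρ | ⟦mapF⟧ (⋀ ys) β ρ = ⋀-++⁻ xs ys

  mapF-⋀-++⁺ : ∀ (xs ys : List (BExpr B R)) {β ρ} → ⟦ mapF f g (⋀ xs) ⟧ β ρ → ⟦ mapF f g (⋀ ys) ⟧ β ρ →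
               ⟦ mapF f g (⋀ (xs ++ ys)) ⟧ β ρ
  mapF-⋀-++⁺ xs ys {β} {ρ}
    rewrite ⟦mapF⟧ (⋀ (xs ++ ys)) β ρ | ⟦mapF⟧ (⋀ xs) β ρ | ⟦mapF⟧ (⋀ ys) β ρ = ⋀-++⁺ xs ys

module _ (nb nr : ℕ) (P : Program nb nr) where

  Inductive-cong : ∀ {I J : InvMap nb nr P} → (∀ ℓ → I ℓ ≡ J ℓ) →
                   Inductive nb nr P I → Inductive nb nr P J
  Inductive-cong I≡J (initiation , consecution) =
      (λ β ρ _ → subst (λ xs → ⟦ ⋀ xs ⟧ β ρ) (I≡J (init P)) (initiation β ρ tt))
    , (λ i j β ρ (hᵢ , t) →
         subst (λ xs → ⟦ nxt nb nr (⋀ xs) ⟧ β ρ) (I≡J j)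
           (consecution i j β ρ (subst (λ xs → ⟦ cur nb nr (⋀ xs) ⟧ β ρ) (sym (I≡J i)) hᵢ , t)))

  Inductive-++ : ∀ {I R : InvMap nb nr P} → Inductive nb nr P I →
                 (∀ {φ} → φ ∈ R (init P) → ⊤ᶠ ⟹ φ) →
                 (∀ i j φ → φ ∈ R j → Kept nb nr P I R i j φ) →
                 Inductive nb nr P (λ ℓ → I ℓ ++ R ℓ)
  Inductive-++ {I} {R} (initiation , consecution) R-initial R-kept =
      (λ β ρ _ → ⋀-++⁺ (I (init P)) (R (init P)) (initiation β ρ tt)
                   (⋀⁺ (R (init P)) (All.tabulate λ φ∈R → R-initial φ∈R β ρ tt)))
    , λ i j β ρ (hᵢ , t) →
        let (hI , hR) = mapF-⋀-++⁻ inj₁ inj₁ (I i) (R i) hᵢ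
        in mapF-⋀-++⁺ inj₂ inj₂ (I j) (R j) (consecution i j β ρ (hI , t))
             (mapF-⋀⁺ inj₂ inj₂ (R j)
               (All.tabulate λ {φ} φ∈R → R-kept i j φ φ∈R β ρ ((hR , hI) , t)))

  update-⊆ : ∀ (R : InvMap nb nr P) j {ys} → ys ⊆ R j → ∀ ℓ → update nb nr P R j ys ℓ ⊆ R ℓ
  update-⊆ R j ys⊆ ℓ with ℓ ≟ j
  ... | yes refl = ys⊆
  ... | no _ = id

  Prune-⊆ : ∀ {I R R'} → Prune nb nr P I R R' → ∀ ℓ → R' ℓ ⊆ R ℓ
  Prune-⊆ (stop _) ℓ = id
  Prune-⊆ {R = R} (remove _ j _ _ _ w pruned) ℓ =
    update-⊆ R j (Without-⊆ w) ℓ ∘ Prune-⊆ pruned ℓ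

  -- The loop stops only when no conjunct violates Kept; turning that negated
  -- existential into Kept itself needs decidability of formula truth.
  Prune-kept : ∀ {I R R'} → Prune nb nr P I R R' → ∀ i j φ → φ ∈ R' j → Kept nb nr P I R' i j φ
  Prune-kept {I} {R} (stop nothing-to-remove) i j φ φ∈R =
    ⟹-stable ((cur nb nr (⋀ (R i)) ∧ᶠ cur nb nr (⋀ (I i))) ∧ᶠ τ P i j) (nxt nb nr φ)
      λ ¬kept → nothing-to-remove (i , j , φ , φ∈R , ¬kept)
  Prune-kept (remove _ _ _ _ _ _ pruned) = Prune-kept pruned

  R₀-sound : ∀ (U : Program nb nr) σ π {u ℓ φ} → σ u ≡ ℓ →
             φ ∈ R₀ nb nr P U σ π ℓ → ⋀ (π u) ⟹ φ
  R₀-sound U σ π {u} {ℓ} σu≡ℓ φ∈R₀ β ρ hπ =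
    conjuncts-sound (⋁ disjuncts) φ∈R₀ (⋁-∈ disjuncts (∈-map⁺ (⋀ ∘ π) u∈fibre) hπ)
    where
      fibre = filter (λ v → σ v ≟ ℓ) (allFin (k U))
      disjuncts = map (⋀ ∘ π) fibre
      u∈fibre : u ∈ fibre
      u∈fibre = ∈-filter⁺ (λ v → σ v ≟ ℓ) (∈-allFin u) σu≡ℓ

  ExtractInvs-inductive : ∀ (U : Program nb nr) σ π {I I'} →
                          Inductive nb nr P I → σ (init U) ≡ init P →
                          (⊤ᶠ ⟹ ⋀ (π (init U))) →
                          ExtractInvs nb nr P U σ π I I' → Inductive nb nr P I'
  ExtractInvs-inductive U σ π {I} I-inductive σ-init π-init (R , pruned , I'≡I++R) =
    Inductive-cong (sym ∘ I'≡I++R)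
      (Inductive-++ {I} {R} I-inductive
        (λ φ∈R β ρ _ → R₀-sound U σ π σ-init (Prune-⊆ pruned (init P) φ∈R) β ρ (π-init β ρ tt))
        (Prune-kept pruned))

  record SpacerInvariant (c : Config nb nr P) : Set where
    constructor invariant
    field
      I-inductive : Inductive nb nr P (I c)
      σ-init      : σ c (init (U c)) ≡ init P

  reachable-invariant : ∀ {c} → Reachable nb nr P c → SpacerInvariant c
  reachable-invariant (start _ _ (_ , σ₀-init , _)) =
    invariant ((λ _ _ _ → tt) , (λ _ _ _ _ _ → tt)) σ₀-init
  reachable-invariant (step {c} r (safe-return _ π (_ , π-init , _) _ extracted _)) =
    let invariant I-inductive σ-init = reachable-invariant r in
    invariant (ExtractInvs-inductive (U c) (σ c) π I-inductive σ-init π-init extracted) σ-init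
  reachable-invariant
    (step {c} r (safe-continue _ π (_ , π-init , _) _ extracted _ _ _ _ _ _ _ _ _ _ _ _ _ (_ , σ₂-init , _) _ _)) =
    let invariant I-inductive σ-init = reachable-invariant r in
    invariant (ExtractInvs-inductive (U c) (σ c) π I-inductive σ-init π-init extracted) σ₂-init
  reachable-invariant (step r (unsafe-return _ _ _ _)) =
    let invariant I-inductive σ-init = reachable-invariant r in invariant I-inductive σ-init
  reachable-invariant (step r (refine _ _ _ _ _ _ _)) =
    let invariant I-inductive σ-init = reachable-invariant r in invariant I-inductive σ-init

lemma1 : (nb nr : ℕ) (P : Program nb nr) → WellFormed nb nr P →
    (c : Config nb nr P) → Reachable nb nr P c → Inductive nb nr P (I c)
lemma1 nb nr P _ c = SpacerInvariant.I-inductive ∘ reachable-invariant nb nr P
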